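{- Let $n,k$ be positive integers with $\gcd(3k,n)=1$, $q=2^n$, and $\phi_k(x,y)=(x^{2^k}+y,\;y^{2^k}+x+y)$ on $\mathbb{F}_q^2$. Then $\phi_k$ is affine ovalinear on $\mathrm{AG}(2,q)$: it is an $\mathbb{F}_2$-linear bijection of $\mathbb{F}_q^2$, and for every line $L$ of $\mathrm{AG}(2,q)$ the image $\phi_k(L)$ contains no three points collinear in $\mathrm{AG}(2,q)$ (equivalently, $\phi_k(L)$ meets every line of $\mathrm{AG}(2,q)$ in at most two points).
   Context: $\mathrm{AG}(2,q)$ is the standard affine plane on $\mathbb{F}_q^2$ with lines $\{(x,y):ax+by=c\}$, $(a,b)\ne(0,0)$. A map on $\mathrm{AG}(2,q)$ is affine ovalinear if it is an $\mathbb{F}_2$-linear bijection mapping lines to ovals (sets with no three collinear points). -}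

module Defs where

open import Level using (Level; _⊔_)
open import Data.Nat using (ℕ; zero; suc; _^_)
open import Data.Fin using (Fin)
open import Data.Product using (_×_; _,_; Σ; proj₁; proj₂)
open import Relation.Nullary using (¬_)
open import Relation.Binary.PropositionalEquality using (_≡_)
open import Algebra.Bundles using (CommutativeRing)

record Field (c ℓ : Level) : Set (Level.suc (c ⊔ ℓ)) where
  field
    commutativeRing : CommutativeRing c ℓ
  open CommutativeRing commutativeRing public
  field
    0≉1     : ¬ (0# ≈ 1#)
    inverse : ∀ x → ¬ (x ≈ 0#) → Σ Carrier λ y → (x * y) ≈ 1#

-- Up to isomorphism this is the field F_q, q = 2^n.
record FieldOfOrder2^ (n : ℕ) (c ℓ : Level) : Set (Level.suc (c ⊔ ℓ)) where
  field
    fld : Field c ℓ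
  open Field fld public
  field
    enum     : Fin (2 ^ n) → Carrier
    enum-inj : ∀ i j → enum i ≈ enum j → i ≡ j
    enum-sur : ∀ x → Σ (Fin (2 ^ n)) λ i → enum i ≈ x

module AffinePlane {c ℓ : Level} (F : Field c ℓ) where
  open Field F

  pow : Carrier → ℕ → Carrier
  pow x zero    = 1#
  pow x (suc m) = x * pow x m

  Point : Set c
  Point = Carrier × Carrier

  _≈P_ : Point → Point → Set ℓ
  (x , y) ≈P (x' , y') = (x ≈ x') × (y ≈ y')

  _+P_ : Point → Point → Point
  (x , y) +P (x' , y') = (x + x') , (y + y')

  record Line : Set (c ⊔ ℓ) where
    constructor line
    field
      a b d   : Carrier
      nonzero : ¬ ((a ≈ 0#) × (b ≈ 0#))

  _∈L_ : Point → Line → Set ℓ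
  (x , y) ∈L L = ((Line.a L * x) + (Line.b L * y)) ≈ Line.d L

  Collinear : Point → Point → Point → Set (c ⊔ ℓ)
  Collinear P Q R = Σ Line λ L → (P ∈L L) × (Q ∈L L) × (R ∈L L)

  record AffineOvalinear (φ : Point → Point) : Set (c ⊔ ℓ) where
    field
      additive   : ∀ P Q → φ (P +P Q) ≈P (φ P +P φ Q)
      injective  : ∀ P Q → φ P ≈P φ Q → P ≈P Q
      surjective : ∀ R → Σ Point λ P → φ P ≈P R
      oval       : ∀ (L : Line) (P Q R : Point) →
                   P ∈L L → Q ∈L L → R ∈L L →
                   ¬ (φ P ≈P φ Q) → ¬ (φ P ≈P φ R) → ¬ (φ Q ≈P φ R) →
                   ¬ Collinear (φ P) (φ Q) (φ R)

  phi : ℕ → Point → Point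
  phi k (x , y) = (pow x (2 ^ k) + y) , ((pow y (2 ^ k) + x) + y)

{-# OPTIONS --safe #-}
-- Write σ x = x ^ (2 ^ k), so that φ_k (x , y) = (σ x + y , σ y + x + y).  As gcd (3k , n) = 1
-- and x ^ (2 ^ n) = x on F_q, every fixed point of σ³ lies in F₂.  This makes the kernel of the
-- additive map φ_k trivial, and finiteness makes it bijective.  If P, Q, R lie on a line, then
-- u = P + Q and w = P + R = l u are parallel, and det (φ u , φ (l u)) = (l + σ l) Q(u) with
-- Q(x , y) = x σx + y σx + y σy.  Here l ∉ F₂ because P, Q, R are distinct, and Q(u) ≠ 0 since
-- Q(x , y) = y σy (t σt + σt + 1) for t = x / y, while t σt + σt = 1 would give σ t = 1 / (1 + t),
-- hence σ³ t = t, i.e. t ∈ F₂, which is absurd.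
module Submission where

open import Defs
open import Level using (Level)
open import Data.Nat as ℕ using (ℕ; zero; suc)
import Data.Nat.Properties as ℕ
open import Data.Nat.GCD using (gcd; GCD; gcd-GCD; module Bézout)
open import Data.Fin as Fin using (Fin; punchOut)
import Data.Fin.Properties as Fin
open import Data.Fin.Permutation using (Permutation; permutation; _⟨$⟩ʳ_)
open import Data.Vec.Functional using (removeAt; replicate)
open import Data.Product using (Σ; ∃; _,_; proj₁; proj₂)
open import Data.Sum using (_⊎_; inj₁; inj₂)
open import Data.Empty using (⊥-elim)
open import Function.Definitions using (Injective)
open import Relation.Nullary using (¬_; Dec; yes; no)
open import Relation.Nullary.Negation using (contradiction)
open import Relation.Binary.PropositionalEquality as ≡ using (_≡_; _≢_)
open import Algebra.Bundles using (CommutativeMonoid; Semiring; CommutativeRing)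
open import Algebra.Morphism.Structures using (module SemiringMorphisms)
import Algebra.Properties.CommutativeMonoid.Sum
import Algebra.Properties.CommutativeSemigroup
import Algebra.Properties.Group
import Algebra.Properties.Semiring.Mult

injective⇒surjective : ∀ {m} (f : Fin m → Fin m) → Injective _≡_ _≡_ f →
                       ∀ j → ∃ λ i → f i ≡ j
injective⇒surjective {suc m} f f-inj j with Fin.any? (λ i → f i Fin.≟ j)
... | yes hit = hit
... | no miss = contradiction (Fin.injective⇒≤ f′-inj) ℕ.1+n≰n
  where
  f′ : Fin (suc m) → Fin m
  f′ i = punchOut (λ fi≡j → miss (i , ≡.sym fi≡j))
  f′-inj : Injective _≡_ _≡_ f′
  f′-inj {i} {i′} eq =
    f-inj (Fin.punchOut-injective (λ e → miss (i , ≡.sym e)) (λ e → miss (i′ , ≡.sym e)) eq)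

injective⇒permutation : ∀ {m} (f : Fin m → Fin m) → Injective _≡_ _≡_ f → Permutation m m
injective⇒permutation f f-inj = permutation f f⁻¹ f∘f⁻¹ (λ i → f-inj (f∘f⁻¹ (f i)))
  where
  f⁻¹ = λ j → proj₁ (injective⇒surjective f f-inj j)
  f∘f⁻¹ = λ j → proj₂ (injective⇒surjective f f-inj j)

module _ {a ℓ} (M : CommutativeMonoid a ℓ) where
  open CommutativeMonoid M
  open import Algebra.Properties.CommutativeMonoid.Sum M
  open import Relation.Binary.Reasoning.Setoid setoid

  sum-single : ∀ {m} (t : Fin m → Carrier) i → (∀ j → j ≢ i → t j ≈ ε) → sum t ≈ t i
  sum-single {suc m} t i vanishes = begin
    sum t                      ≈⟨ sum-remove t ⟩
    t i ∙ sum (removeAt t i)   ≈⟨ ∙-congˡ (sum-cong-≋ (λ j → vanishes _ (Fin.punchInᵢ≢i i j))) ⟩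
    t i ∙ sum (replicate m ε)  ≈⟨ ∙-congˡ (sum-replicate-zero m) ⟩
    t i ∙ ε                    ≈⟨ identityʳ (t i) ⟩
    t i                        ∎

module TwoPowerExponents {a ℓ} (S : Semiring a ℓ) where
  open Semiring S
  open import Algebra.Properties.Semiring.Exp S
  open import Relation.Binary.Reasoning.Setoid setoid

  x^2^[m+n]≈[x^2^m]^2^n : ∀ x m n → x ^ (2 ℕ.^ (m ℕ.+ n)) ≈ (x ^ (2 ℕ.^ m)) ^ (2 ℕ.^ n)
  x^2^[m+n]≈[x^2^m]^2^n x m n = begin
    x ^ (2 ℕ.^ (m ℕ.+ n))        ≡⟨ ≡.cong (x ^_) (ℕ.^-distribˡ-+-* 2 m n) ⟩
    x ^ (2 ℕ.^ m ℕ.* 2 ℕ.^ n)    ≈⟨ ^-assocʳ x (2 ℕ.^ m) (2 ℕ.^ n) ⟨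
    (x ^ (2 ℕ.^ m)) ^ (2 ℕ.^ n)  ∎

  ^2^-fixed-* : ∀ {x m} → x ^ (2 ℕ.^ m) ≈ x → ∀ i → x ^ (2 ℕ.^ (i ℕ.* m)) ≈ x
  ^2^-fixed-* {x} _ zero = *-identityʳ x
  ^2^-fixed-* {x} {m} fixed (suc i) = begin
    x ^ (2 ℕ.^ (m ℕ.+ i ℕ.* m))          ≈⟨ x^2^[m+n]≈[x^2^m]^2^n x m (i ℕ.* m) ⟩
    (x ^ (2 ℕ.^ m)) ^ (2 ℕ.^ (i ℕ.* m))  ≈⟨ ^-congˡ (2 ℕ.^ (i ℕ.* m)) fixed ⟩
    x ^ (2 ℕ.^ (i ℕ.* m))                ≈⟨ ^2^-fixed-* fixed i ⟩
    x                                    ∎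

  ^2^-fixed-Bézout : ∀ {x p q} i j → x ^ (2 ℕ.^ p) ≈ x → x ^ (2 ℕ.^ q) ≈ x →
                     1 ℕ.+ i ℕ.* p ≡ j ℕ.* q → x ^ 2 ≈ x
  ^2^-fixed-Bézout {x} {p} {q} i j p-fixed q-fixed eq = begin
    x ^ 2                                ≈⟨ ^-congˡ 2 (^2^-fixed-* p-fixed i) ⟨
    (x ^ (2 ℕ.^ (i ℕ.* p))) ^ (2 ℕ.^ 1)  ≈⟨ x^2^[m+n]≈[x^2^m]^2^n x (i ℕ.* p) 1 ⟨
    x ^ (2 ℕ.^ (i ℕ.* p ℕ.+ 1))          ≡⟨ ≡.cong (λ e → x ^ (2 ℕ.^ e)) (≡.trans (ℕ.+-comm _ 1) eq) ⟩
    x ^ (2 ℕ.^ (j ℕ.* q))                ≈⟨ ^2^-fixed-* q-fixed j ⟩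
    x                                    ∎

  ^2^-fixed-coprime : ∀ {x m n} → x ^ (2 ℕ.^ m) ≈ x → x ^ (2 ℕ.^ n) ≈ x →
                      gcd m n ≡ 1 → x ^ 2 ≈ x
  ^2^-fixed-coprime {x} {m} {n} m-fixed n-fixed coprime
    with Bézout.identity (≡.subst (GCD m n) coprime (gcd-GCD m n))
  ... | Bézout.+- i j eq = ^2^-fixed-Bézout j i n-fixed m-fixed eq
  ... | Bézout.-+ i j eq = ^2^-fixed-Bézout i j m-fixed n-fixed eq

HasCharacteristicTwo : ∀ {c ℓ} → CommutativeRing c ℓ → Set ℓ
HasCharacteristicTwo R = 1# + 1# ≈ 0#
  where open CommutativeRing R

module CharacteristicTwo {c ℓ} (R : CommutativeRing c ℓ) (char₂ : HasCharacteristicTwo R) where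
  open CommutativeRing R
  open import Algebra.Properties.CommutativeSemiring.Exp commutativeSemiring
  open TwoPowerExponents semiring using (x^2^[m+n]≈[x^2^m]^2^n)
  open Algebra.Properties.Group +-group using () renaming (∙-cancelʳ to +-cancelʳ)
  open import Relation.Binary.Reasoning.Setoid setoid
  open import Algebra.Solver.Ring.NaturalCoefficients.Default commutativeSemiring

  x+x≈0 : ∀ x → x + x ≈ 0#
  x+x≈0 x = begin
    x + x            ≈⟨ +-cong (*-identityˡ x) (*-identityˡ x) ⟨
    1# * x + 1# * x  ≈⟨ distribʳ x 1# 1# ⟨
    (1# + 1#) * x    ≈⟨ *-congʳ char₂ ⟩
    0# * x           ≈⟨ zeroˡ x ⟩
    0#               ∎

  x+y≈0⇒x≈y : ∀ {x y} → x + y ≈ 0# → x ≈ y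
  x+y≈0⇒x≈y {x} {y} eq = +-cancelʳ y x y (trans eq (sym (x+x≈0 y)))

  x≈y⇒x+y≈0 : ∀ {x y} → x ≈ y → x + y ≈ 0#
  x≈y⇒x+y≈0 {x} {y} eq = trans (+-congʳ eq) (x+x≈0 y)

  x+y≈z⇒x≈z+y : ∀ {x y z} → x + y ≈ z → x ≈ z + y
  x+y≈z⇒x≈z+y {x} {y} {z} eq = begin
    x            ≈⟨ +-identityʳ x ⟨
    x + 0#       ≈⟨ +-congˡ (x+x≈0 y) ⟨
    x + (y + y)  ≈⟨ +-assoc x y y ⟨
    (x + y) + y  ≈⟨ +-congʳ eq ⟩
    z + y        ∎

  ^2-distrib-+ : ∀ x y → (x + y) ^ 2 ≈ x ^ 2 + y ^ 2
  ^2-distrib-+ x y = begin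
    (x + y) ^ 2                        ≈⟨ expand x y ⟩
    (x ^ 2 + y ^ 2) + (x * y + x * y)  ≈⟨ +-congˡ (x+x≈0 (x * y)) ⟩
    (x ^ 2 + y ^ 2) + 0#               ≈⟨ +-identityʳ _ ⟩
    x ^ 2 + y ^ 2                      ∎
    where
    expand : ∀ x y → (x + y) ^ 2 ≈ (x ^ 2 + y ^ 2) + (x * y + x * y)
    expand = solve 2 (λ x y → (x :+ y) :* ((x :+ y) :* con 1) :=
      (x :* (x :* con 1) :+ y :* (y :* con 1)) :+ (x :* y :+ x :* y)) refl

  ^2^-distrib-+ : ∀ m x y → (x + y) ^ (2 ℕ.^ m) ≈ x ^ (2 ℕ.^ m) + y ^ (2 ℕ.^ m)
  ^2^-distrib-+ zero x y = trans (*-identityʳ _) (sym (+-cong (*-identityʳ x) (*-identityʳ y)))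
  ^2^-distrib-+ (suc m) x y = begin
    (x + y) ^ (2 ℕ.^ suc m)                    ≈⟨ x^2^[m+n]≈[x^2^m]^2^n (x + y) 1 m ⟩
    ((x + y) ^ 2) ^ (2 ℕ.^ m)                  ≈⟨ ^-congˡ (2 ℕ.^ m) (^2-distrib-+ x y) ⟩
    (x ^ 2 + y ^ 2) ^ (2 ℕ.^ m)                ≈⟨ ^2^-distrib-+ m (x ^ 2) (y ^ 2) ⟩
    (x ^ 2) ^ (2 ℕ.^ m) + (y ^ 2) ^ (2 ℕ.^ m)  ≈⟨ +-cong (x^2^[m+n]≈[x^2^m]^2^n x 1 m)
                                                         (x^2^[m+n]≈[x^2^m]^2^n y 1 m) ⟨
    x ^ (2 ℕ.^ suc m) + y ^ (2 ℕ.^ suc m)      ∎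

module FieldProperties {c ℓ} (F : Field c ℓ) where
  open Field F
  open AffinePlane F using (pow)
  open import Algebra.Properties.CommutativeSemiring.Exp commutativeSemiring
  open SemiringMorphisms (Semiring.rawSemiring semiring) (Semiring.rawSemiring semiring)
    using (IsSemiringHomomorphism)
  module Mult = Algebra.Properties.Semiring.Mult semiring
  open import Relation.Binary.Reasoning.Setoid setoid

  *-cancelˡ : ∀ {a x y} → a ≉ 0# → a * x ≈ a * y → x ≈ y
  *-cancelˡ {a} {x} {y} a≉0 eq = begin
    x              ≈⟨ *-identityˡ x ⟨
    1# * x         ≈⟨ *-congʳ a⁻¹*a≈1 ⟨
    (a⁻¹ * a) * x  ≈⟨ *-assoc a⁻¹ a x ⟩
    a⁻¹ * (a * x)  ≈⟨ *-congˡ eq ⟩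
    a⁻¹ * (a * y)  ≈⟨ *-assoc a⁻¹ a y ⟨
    (a⁻¹ * a) * y  ≈⟨ *-congʳ a⁻¹*a≈1 ⟩
    1# * y         ≈⟨ *-identityˡ y ⟩
    y              ∎
    where
    a⁻¹ = proj₁ (inverse a a≉0)
    a⁻¹*a≈1 : a⁻¹ * a ≈ 1#
    a⁻¹*a≈1 = trans (*-comm a⁻¹ a) (proj₂ (inverse a a≉0))

  x≉0∧y≉0⇒x*y≉0 : ∀ {x y} → x ≉ 0# → y ≉ 0# → x * y ≉ 0#
  x≉0∧y≉0⇒x*y≉0 {x} x≉0 y≉0 xy≈0 = y≉0 (*-cancelˡ x≉0 (trans xy≈0 (sym (zeroʳ x))))

  ≉0⇒quotient : ∀ {y} → y ≉ 0# → ∀ x → Σ Carrier λ t → x ≈ t * y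
  ≉0⇒quotient {y} y≉0 x = x * y⁻¹ , sym (begin
    (x * y⁻¹) * y  ≈⟨ *-assoc x y⁻¹ y ⟩
    x * (y⁻¹ * y)  ≈⟨ *-congˡ (trans (*-comm y⁻¹ y) (proj₂ (inverse y y≉0))) ⟩
    x * 1#         ≈⟨ *-identityʳ x ⟩
    x              ∎)
    where y⁻¹ = proj₁ (inverse y y≉0)

  module DecidableZero (_≟0 : ∀ x → Dec (x ≈ 0#)) where

    x*y≈0⇒x≈0∨y≈0 : ∀ {x y} → x * y ≈ 0# → x ≈ 0# ⊎ y ≈ 0#
    x*y≈0⇒x≈0∨y≈0 {x} xy≈0 with x ≟0
    ... | yes x≈0 = inj₁ x≈0
    ... | no  x≉0 = inj₂ (*-cancelˡ x≉0 (trans xy≈0 (sym (zeroʳ x))))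

    x^2≈x⇒x≈0∨x≈1 : ∀ {x} → x ^ 2 ≈ x → x ≈ 0# ⊎ x ≈ 1#
    x^2≈x⇒x≈0∨x≈1 {x} x²≈x with x ≟0
    ... | yes x≈0 = inj₁ x≈0
    ... | no  x≉0 = inj₂ (trans (sym (*-identityʳ x))
                                (*-cancelˡ x≉0 (trans x²≈x (sym (*-identityʳ x)))))

    2^m×1≈0⇒char₂ : ∀ m → (2 ℕ.^ m) Mult.× 1# ≈ 0# → HasCharacteristicTwo commutativeRing
    2^m×1≈0⇒char₂ zero 1≈0 = ⊥-elim (0≉1 (sym (trans (sym (+-identityʳ 1#)) 1≈0)))
    2^m×1≈0⇒char₂ (suc m) eq
      with x*y≈0⇒x≈0∨y≈0 (trans (sym (Mult.×1-homo-* 2 (2 ℕ.^ m))) eq)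
    ... | inj₁ 2×1≈0 = trans (+-congˡ (sym (+-identityʳ 1#))) 2×1≈0
    ... | inj₂ 2^m×1≈0 = 2^m×1≈0⇒char₂ m 2^m×1≈0

  pow≡^ : ∀ x m → pow x m ≡ x ^ m
  pow≡^ x zero = ≡.refl
  pow≡^ x (suc m) = ≡.cong (x *_) (pow≡^ x m)

  frobenius : ℕ → Carrier → Carrier
  frobenius m x = pow x (2 ℕ.^ m)

  frobenius³ : ∀ m x → frobenius m (frobenius m (frobenius m x)) ≈ x ^ (2 ℕ.^ (3 ℕ.* m))
  frobenius³ m x = begin
    pow (pow (pow x e) e) e              ≡⟨ ≡.trans (pow≡^ _ e) (≡.cong (_^ e) pow²≡^²) ⟩
    ((x ^ e) ^ e) ^ e                    ≡⟨ ≡.cong (λ i → ((x ^ e) ^ e) ^ (2 ℕ.^ i)) (ℕ.+-identityʳ m) ⟨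
    ((x ^ e) ^ e) ^ (2 ℕ.^ (m ℕ.+ 0))    ≈⟨ x^2^[m+n]≈[x^2^m]^2^n (x ^ e) m (m ℕ.+ 0) ⟨
    (x ^ e) ^ (2 ℕ.^ (m ℕ.+ (m ℕ.+ 0)))  ≈⟨ x^2^[m+n]≈[x^2^m]^2^n x m (m ℕ.+ (m ℕ.+ 0)) ⟨
    x ^ (2 ℕ.^ (3 ℕ.* m))                ∎
    where
    open TwoPowerExponents semiring using (x^2^[m+n]≈[x^2^m]^2^n)
    e = 2 ℕ.^ m
    pow²≡^² : pow (pow x e) e ≡ (x ^ e) ^ e
    pow²≡^² = ≡.trans (pow≡^ _ e) (≡.cong (_^ e) (pow≡^ x e))

  module _ (char₂ : HasCharacteristicTwo commutativeRing) where
    open CharacteristicTwo commutativeRing char₂ using (x+x≈0; x+y≈z⇒x≈z+y; ^2^-distrib-+)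
    open import Algebra.Solver.Ring.NaturalCoefficients.Default commutativeSemiring

    frobenius-isSemiringHomomorphism : ∀ m → IsSemiringHomomorphism (frobenius m)
    frobenius-isSemiringHomomorphism m = record
      { isNearSemiringHomomorphism = record
        { +-isMonoidHomomorphism = record
          { isMagmaHomomorphism = record
            { isRelHomomorphism = record { cong = σ-cong }
            ; homo = σ-+
            }
          ; ε-homo = σ-0
          }
        ; *-homo = σ-*
        }
      ; 1#-homo = σ-1
      }
      where
      e = 2 ℕ.^ m
      σ = frobenius m
      σ≈^ : ∀ x → σ x ≈ x ^ e
      σ≈^ x = reflexive (pow≡^ x e)
      σ-cong : ∀ {x y} → x ≈ y → σ x ≈ σ y
      σ-cong {x} {y} x≈y = trans (σ≈^ x) (trans (^-congˡ e x≈y) (sym (σ≈^ y)))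
      σ-+ : ∀ x y → σ (x + y) ≈ σ x + σ y
      σ-+ x y = trans (σ≈^ (x + y))
                      (trans (^2^-distrib-+ m x y) (sym (+-cong (σ≈^ x) (σ≈^ y))))
      σ-* : ∀ x y → σ (x * y) ≈ σ x * σ y
      σ-* x y = trans (σ≈^ (x * y)) (trans (^-distrib-* x y e) (sym (*-cong (σ≈^ x) (σ≈^ y))))
      σ-0 : σ 0# ≈ 0#
      σ-0 = trans (σ-cong (sym (+-identityʳ 0#))) (trans (σ-+ 0# 0#) (x+x≈0 (σ 0#)))
      1^i≈1 : ∀ i → pow 1# i ≈ 1#
      1^i≈1 zero = refl
      1^i≈1 (suc i) = trans (*-identityˡ _) (1^i≈1 i)
      σ-1 : σ 1# ≈ 1#
      σ-1 = 1^i≈1 e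

    -- b = 1 / (1 + a), c = 1 / (1 + b), d = 1 / (1 + c): in characteristic two the Möbius map
    -- z ↦ 1 / (1 + z) has order three.
    möbius-cycle : ∀ {a b c d} → a * b + b ≈ 1# → b * c + c ≈ 1# → c * d + d ≈ 1# → d ≈ a
    möbius-cycle {a} {b} {c} {d} ab+b≈1 bc+c≈1 cd+d≈1 =
      *-cancelˡ c+1≉0 (trans [c+1]d≈1 (sym [c+1]a≈1))
      where
      [c+1]d≈1 : (c + 1#) * d ≈ 1#
      [c+1]d≈1 = trans (distribʳ d c 1#) (trans (+-congˡ (*-identityˡ d)) cd+d≈1)
      c+1≉0 : c + 1# ≉ 0#
      c+1≉0 c+1≈0 = 0≉1 (trans (sym (trans (*-congʳ c+1≈0) (zeroˡ d))) [c+1]d≈1)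
      b≉0 : b ≉ 0#
      b≉0 b≈0 = 0≉1 (begin
        0#            ≈⟨ +-identityʳ 0# ⟨
        0# + 0#       ≈⟨ +-cong (trans (*-congˡ b≈0) (zeroʳ a)) b≈0 ⟨
        a * b + b     ≈⟨ ab+b≈1 ⟩
        1#            ∎)
      ab≈1+b : a * b ≈ 1# + b
      ab≈1+b = x+y≈z⇒x≈z+y ab+b≈1
      [c+1]a≈1 : (c + 1#) * a ≈ 1#
      [c+1]a≈1 = *-cancelˡ b≉0 (begin
        b * ((c + 1#) * a)       ≈⟨ solve 3 (λ a b c → b :* ((c :+ con 1) :* a) :=
                                      (a :* b) :* c :+ a :* b) refl a b c ⟩
        (a * b) * c + a * b      ≈⟨ +-cong (*-congʳ ab≈1+b) ab≈1+b ⟩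
        (1# + b) * c + (1# + b)  ≈⟨ solve 2 (λ b c → (con 1 :+ b) :* c :+ (con 1 :+ b) :=
                                      (b :* c :+ c) :+ (con 1 :+ b)) refl b c ⟩
        (b * c + c) + (1# + b)   ≈⟨ +-congʳ bc+c≈1 ⟩
        1# + (1# + b)            ≈⟨ +-assoc 1# 1# b ⟨
        (1# + 1#) + b            ≈⟨ +-congʳ char₂ ⟩
        0# + b                   ≈⟨ +-identityˡ b ⟩
        b                        ≈⟨ *-identityʳ b ⟨
        b * 1#                   ∎)

module FiniteField {n c ℓ} (F : FieldOfOrder2^ n c ℓ) where
  open FieldOfOrder2^ F
  open FieldProperties fld
  open AffinePlane fld using (Point; _≈P_)
  open import Algebra.Properties.CommutativeSemiring.Exp commutativeSemiring
  module Σ+ = Algebra.Properties.CommutativeMonoid.Sum +-commutativeMonoid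
  module Π* = Algebra.Properties.CommutativeMonoid.Sum *-commutativeMonoid
  open import Relation.Binary.Reasoning.Setoid setoid

  N : ℕ
  N = 2 ℕ.^ n

  index : Carrier → Fin N
  index x = proj₁ (enum-sur x)

  enum-index : ∀ x → enum (index x) ≈ x
  enum-index x = proj₂ (enum-sur x)

  index-cong : ∀ {x y} → x ≈ y → index x ≡ index y
  index-cong {x} {y} x≈y = enum-inj _ _ (trans (enum-index x) (trans x≈y (sym (enum-index y))))

  index-enum : ∀ i → index (enum i) ≡ i
  index-enum i = enum-inj _ _ (enum-index (enum i))

  index-injective : ∀ {x y} → index x ≡ index y → x ≈ y
  index-injective {x} {y} eq =
    trans (sym (enum-index x)) (trans (reflexive (≡.cong enum eq)) (enum-index y))

  _≟0 : ∀ x → Dec (x ≈ 0#)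
  x ≟0 with index x Fin.≟ index 0#
  ... | yes eq = yes (index-injective eq)
  ... | no  ne = no (λ x≈0 → ne (index-cong x≈0))

  open DecidableZero _≟0

  module _ {a ℓ′} (M : CommutativeMonoid a ℓ′) where
    private module M = CommutativeMonoid M
    open Algebra.Properties.CommutativeMonoid.Sum M using (sum; sum-permute; sum-cong-≋)

    sum-reindex : (h : Carrier → M.Carrier) → (∀ {x y} → x ≈ y → h x M.≈ h y) →
                  (f : Carrier → Carrier) → (∀ {x y} → f x ≈ f y → x ≈ y) →
                  sum (λ i → h (enum i)) M.≈ sum (λ i → h (f (enum i)))
    sum-reindex h h-cong f f-inj =
      M.trans (sum-permute (λ i → h (enum i)) π)
              (sum-cong-≋ {N} {λ i → h (enum (π ⟨$⟩ʳ i))} {λ i → h (f (enum i))}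
                          (λ i → h-cong (enum-index (f (enum i)))))
      where
      π = injective⇒permutation (λ i → index (f (enum i)))
                                (λ eq → enum-inj _ _ (f-inj (index-injective eq)))

  char₂ : HasCharacteristicTwo commutativeRing
  char₂ = 2^m×1≈0⇒char₂ n (sym (+-cancelˡ S 0# (N Mult.× 1#) (begin
    S + 0#                       ≈⟨ +-identityʳ S ⟩
    S                            ≈⟨ sum-reindex +-commutativeMonoid (λ x → x) (λ x≈y → x≈y)
                                      (_+ 1#) (λ {x} {y} → +-cancelʳ 1# x y) ⟩
    Σ+.sum (λ i → enum i + 1#)   ≈⟨ Σ+.∑-distrib-+ enum (λ _ → 1#) ⟩
    S + Σ+.sum (replicate N 1#)  ≈⟨ +-congˡ (Σ+.sum-replicate N) ⟩
    S + N Mult.× 1#              ∎)))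
    where
    S = Σ+.sum enum
    open Algebra.Properties.Group +-group
      using () renaming (∙-cancelˡ to +-cancelˡ; ∙-cancelʳ to +-cancelʳ)

  ifZero_then_else_ : Carrier → Carrier → Carrier → Carrier
  ifZero x then u else v with x ≟0
  ... | yes _ = u
  ... | no  _ = v

  ifZero-≈0 : ∀ {x} u v → x ≈ 0# → (ifZero x then u else v) ≈ u
  ifZero-≈0 {x} u v x≈0 with x ≟0
  ... | yes _   = refl
  ... | no  x≉0 = ⊥-elim (x≉0 x≈0)

  ifZero-≉0 : ∀ {x} u v → x ≉ 0# → (ifZero x then u else v) ≈ v
  ifZero-≉0 {x} u v x≉0 with x ≟0
  ... | yes x≈0 = ⊥-elim (x≉0 x≈0)
  ... | no  _   = refl

  unitPart : Carrier → Carrier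
  unitPart x = ifZero x then 1# else x

  unitPart-≉0 : ∀ x → unitPart x ≉ 0#
  unitPart-≉0 x with x ≟0
  ... | yes _   = λ 1≈0 → 0≉1 (sym 1≈0)
  ... | no  x≉0 = x≉0

  unitPart-cong : ∀ {x y} → x ≈ y → unitPart x ≈ unitPart y
  unitPart-cong {x} {y} x≈y with y ≟0
  ... | yes y≈0 = ifZero-≈0 1# x (trans x≈y y≈0)
  ... | no  y≉0 = trans (ifZero-≉0 1# x (λ x≈0 → y≉0 (trans (sym x≈y) x≈0))) x≈y

  unitPart-* : ∀ {a} → a ≉ 0# → ∀ x → a * unitPart x ≈ unitPart (a * x) * (ifZero x then a else 1#)
  unitPart-* {a} a≉0 x = by-cases (x ≟0)
    where
    by-cases : Dec (x ≈ 0#) → a * unitPart x ≈ unitPart (a * x) * (ifZero x then a else 1#)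
    by-cases (yes x≈0) = begin
      a * unitPart x                              ≈⟨ *-congˡ (ifZero-≈0 1# x x≈0) ⟩
      a * 1#                                      ≈⟨ *-comm a 1# ⟩
      1# * a                                      ≈⟨ *-cong (ifZero-≈0 1# (a * x) ax≈0)
                                                            (ifZero-≈0 a 1# x≈0) ⟨
      unitPart (a * x) * (ifZero x then a else 1#)  ∎
      where ax≈0 = trans (*-congˡ x≈0) (zeroʳ a)
    by-cases (no x≉0) = begin
      a * unitPart x                              ≈⟨ *-congˡ (ifZero-≉0 1# x x≉0) ⟩
      a * x                                       ≈⟨ *-identityʳ (a * x) ⟨
      (a * x) * 1#                                ≈⟨ *-cong (ifZero-≉0 1# (a * x) ax≉0)
                                                            (ifZero-≉0 a 1# x≉0) ⟨
      unitPart (a * x) * (ifZero x then a else 1#)  ∎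
      where ax≉0 = x≉0∧y≉0⇒x*y≉0 a≉0 x≉0

  ∏-ifZero : ∀ a → Π*.sum (λ i → ifZero enum i then a else 1#) ≈ a
  ∏-ifZero a = trans (sum-single *-commutativeMonoid _ (index 0#) away-from-0)
                     (ifZero-≈0 a 1# (enum-index 0#))
    where
    away-from-0 : ∀ j → j ≢ index 0# → (ifZero enum j then a else 1#) ≈ 1#
    away-from-0 j j≢0 =
      ifZero-≉0 a 1# (λ eq → j≢0 (≡.trans (≡.sym (index-enum j)) (index-cong eq)))

  ∏-≉0 : ∀ {m} (t : Fin m → Carrier) → (∀ i → t i ≉ 0#) → Π*.sum t ≉ 0#
  ∏-≉0 {zero} t _ 1≈0 = 0≉1 (sym 1≈0)
  ∏-≉0 {suc m} t t≉0 =
    x≉0∧y≉0⇒x*y≉0 (t≉0 Fin.zero) (∏-≉0 (λ i → t (Fin.suc i)) (λ i → t≉0 (Fin.suc i)))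

  -- Multiplication by a ≉ 0 permutes F, so ∏ unitPart (a x) = ∏ unitPart x, while
  -- ∏ a * unitPart x = a ^ N * ∏ unitPart x; the two differ only by the factor at x = 0.
  x^N≈x : ∀ x → x ^ N ≈ x
  x^N≈x a with a ≟0
  ... | yes a≈0 = trans (a^m≈0 N {{ℕ.m^n≢0 2 n}}) (sym a≈0)
    where
    a^m≈0 : ∀ m → .{{ℕ.NonZero m}} → a ^ m ≈ 0#
    a^m≈0 (suc m) = trans (*-congʳ a≈0) (zeroˡ _)
  ... | no a≉0 = *-cancelˡ (∏-≉0 (λ i → unitPart (enum i)) (λ i → unitPart-≉0 (enum i))) (begin
    P * a ^ N                                    ≈⟨ *-comm P (a ^ N) ⟩
    a ^ N * P                                    ≈⟨ *-congʳ (Π*.sum-replicate N) ⟨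
    Π*.sum (replicate N a) * P                   ≈⟨ Π*.∑-distrib-+ (λ _ → a) (λ i → unitPart (enum i)) ⟨
    Π*.sum (λ i → a * unitPart (enum i))         ≈⟨ Π*.sum-cong-≋ (λ i → unitPart-* a≉0 (enum i)) ⟩
    Π*.sum (λ i → unitPart (a * enum i) * ifZero enum i then a else 1#)
                                                 ≈⟨ Π*.∑-distrib-+ (λ i → unitPart (a * enum i)) _ ⟩
    Π*.sum (λ i → unitPart (a * enum i)) * Π*.sum (λ i → ifZero enum i then a else 1#)
                                                 ≈⟨ *-cong (sym (sum-reindex *-commutativeMonoid unitPart
                                                                   unitPart-cong (a *_) (*-cancelˡ a≉0)))
                                                           (∏-ifZero a) ⟩
    P * a                                        ∎)
    where P = Π*.sum (λ i → unitPart (enum i))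

  ^2^-fixed⇒0∨1 : ∀ {m t} → gcd m n ≡ 1 → t ^ (2 ℕ.^ m) ≈ t → t ≈ 0# ⊎ t ≈ 1#
  ^2^-fixed⇒0∨1 {m} {t} coprime fixed =
    x^2≈x⇒x≈0∨x≈1 (^2^-fixed-coprime {t} {m} {n} fixed (x^N≈x t) coprime)
    where open TwoPowerExponents semiring using (^2^-fixed-coprime)

  encodePoint : Point → Fin (N ℕ.* N)
  encodePoint (x , y) = Fin.combine (index x) (index y)

  decodePoint : Fin (N ℕ.* N) → Point
  decodePoint i = enum (proj₁ (Fin.remQuot {N} N i)) , enum (proj₂ (Fin.remQuot {N} N i))

  encodePoint-injective : ∀ {P Q} → encodePoint P ≡ encodePoint Q → P ≈P Q
  encodePoint-injective {x , y} {x′ , y′} eq =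
    index-injective (proj₁ components) , index-injective (proj₂ components)
    where components = Fin.combine-injective (index x) (index y) (index x′) (index y′) eq

  decodePoint-injective : ∀ {i j} → decodePoint i ≈P decodePoint j → i ≡ j
  decodePoint-injective {i} {j} (x≈x′ , y≈y′) =
    ≡.trans (≡.sym (Fin.combine-remQuot {N} N i))
      (≡.trans (≡.cong₂ Fin.combine (enum-inj _ _ x≈x′) (enum-inj _ _ y≈y′))
               (Fin.combine-remQuot {N} N j))

  point-injective⇒surjective : (f : Point → Point) → (∀ P Q → f P ≈P f Q → P ≈P Q) →
                               ∀ R → Σ Point λ P → f P ≈P R
  point-injective⇒surjective f f-inj R = decodePoint i , encodePoint-injective fi≡R
    where
    g : Fin (N ℕ.* N) → Fin (N ℕ.* N)
    g i = encodePoint (f (decodePoint i))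
    g-injective : Injective _≡_ _≡_ g
    g-injective eq = decodePoint-injective (f-inj _ _ (encodePoint-injective eq))
    i = proj₁ (injective⇒surjective g g-injective (encodePoint R))
    fi≡R = proj₂ (injective⇒surjective g g-injective (encodePoint R))

module _ {c ℓ} (F : Field c ℓ) where
  open Field F
  open FieldProperties F using (*-cancelˡ; x≉0∧y≉0⇒x*y≉0; ≉0⇒quotient)
  open AffinePlane F using (Point; _≈P_; _+P_; Line; line; _∈L_; Collinear)
  open SemiringMorphisms (Semiring.rawSemiring semiring) (Semiring.rawSemiring semiring)
    using (IsSemiringHomomorphism)
  open import Relation.Binary.Reasoning.Setoid setoid
  open import Algebra.Solver.Ring.NaturalCoefficients.Default commutativeSemiring

  module CharacteristicTwoPlane (_≟0 : ∀ x → Dec (x ≈ 0#))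
                                (char₂ : HasCharacteristicTwo commutativeRing) where
    open CharacteristicTwo commutativeRing char₂ using (x+x≈0; x+y≈0⇒x≈y; x≈y⇒x+y≈0)

    _·P_ : Carrier → Point → Point
    l ·P (x , y) = (l * x) , (l * y)

    -- In characteristic two the determinant needs no sign.
    det : Point → Point → Carrier
    det (x , y) (x′ , y′) = x * y′ + y * x′

    det-cong : ∀ {u u′ w w′} → u ≈P u′ → w ≈P w′ → det u w ≈ det u′ w′
    det-cong (x≈ , y≈) (x′≈ , y′≈) = +-cong (*-cong x≈ y′≈) (*-cong y≈ x′≈)

    det≈0⇒proportional : ∀ {u w} → ¬ u ≈P (0# , 0#) → det u w ≈ 0# →
                         Σ Carrier λ l → w ≈P (l ·P u)
    det≈0⇒proportional {x , y} {x′ , y′} u≉0 det≈0 with x ≟0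
    ... | no x≉0 = l , x′≈lx , *-cancelˡ x≉0 (begin
        x * y′       ≈⟨ x+y≈0⇒x≈y det≈0 ⟩
        y * x′       ≈⟨ *-congˡ x′≈lx ⟩
        y * (l * x)  ≈⟨ solve 3 (λ x y l → y :* (l :* x) := x :* (l :* y)) refl x y l ⟩
        x * (l * y)  ∎)
      where
      l = proj₁ (≉0⇒quotient x≉0 x′)
      x′≈lx = proj₂ (≉0⇒quotient x≉0 x′)
    ... | yes x≈0 = l , *-cancelˡ y≉0 (begin
        y * x′       ≈⟨ x+y≈0⇒x≈y det≈0 ⟨
        x * y′       ≈⟨ *-congˡ y′≈ly ⟩
        x * (l * y)  ≈⟨ solve 3 (λ x y l → x :* (l :* y) := y :* (l :* x)) refl x y l ⟩
        y * (l * x)  ∎) , y′≈ly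
      where
      y≉0 : y ≉ 0#
      y≉0 y≈0 = u≉0 (x≈0 , y≈0)
      l = proj₁ (≉0⇒quotient y≉0 y′)
      y′≈ly = proj₂ (≉0⇒quotient y≉0 y′)

    _∥L_ : Point → Line → Set ℓ
    (x , y) ∥L L = Line.a L * x + Line.b L * y ≈ 0#

    ∈L⇒+P-∥L : ∀ {P Q} L → P ∈L L → Q ∈L L → (P +P Q) ∥L L
    ∈L⇒+P-∥L {x , y} {x′ , y′} (line a b d _) P∈L Q∈L = begin
      a * (x + x′) + b * (y + y′)          ≈⟨ solve 6 (λ a b x y x′ y′ →
                                                 a :* (x :+ x′) :+ b :* (y :+ y′) :=
                                                 (a :* x :+ b :* y) :+ (a :* x′ :+ b :* y′))
                                                 refl a b x y x′ y′ ⟩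
      (a * x + b * y) + (a * x′ + b * y′)  ≈⟨ +-cong P∈L Q∈L ⟩
      d + d                                ≈⟨ x+x≈0 d ⟩
      0#                                   ∎

    ∥L⇒det≈0 : ∀ {u w} L → u ∥L L → w ∥L L → det u w ≈ 0#
    ∥L⇒det≈0 {x , y} {x′ , y′} (line a b _ nonzero) u∥L w∥L with a ≟0
    ... | no a≉0 = *-cancelˡ a≉0 (begin
      a * (x * y′ + y * x′)        ≈⟨ solve 5 (λ a x y x′ y′ → a :* (x :* y′ :+ y :* x′) :=
                                        (a :* x) :* y′ :+ (a :* x′) :* y) refl a x y x′ y′ ⟩
      (a * x) * y′ + (a * x′) * y  ≈⟨ +-cong (*-congʳ (x+y≈0⇒x≈y u∥L)) (*-congʳ (x+y≈0⇒x≈y w∥L)) ⟩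
      (b * y) * y′ + (b * y′) * y  ≈⟨ x≈y⇒x+y≈0 (solve 3 (λ b y y′ → (b :* y) :* y′ :=
                                        (b :* y′) :* y) refl b y y′) ⟩
      0#                           ≈⟨ zeroʳ a ⟨
      a * 0#                       ∎)
    ... | yes a≈0 = *-cancelˡ b≉0 (begin
      b * (x * y′ + y * x′)        ≈⟨ solve 5 (λ b x y x′ y′ → b :* (x :* y′ :+ y :* x′) :=
                                        (b :* y′) :* x :+ (b :* y) :* x′) refl b x y x′ y′ ⟩
      (b * y′) * x + (b * y) * x′  ≈⟨ +-cong (*-congʳ (sym (x+y≈0⇒x≈y w∥L)))
                                             (*-congʳ (sym (x+y≈0⇒x≈y u∥L))) ⟩
      (a * x′) * x + (a * x) * x′  ≈⟨ x≈y⇒x+y≈0 (solve 3 (λ a x x′ → (a :* x′) :* x :=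
                                        (a :* x) :* x′) refl a x x′) ⟩
      0#                           ≈⟨ zeroʳ b ⟨
      b * 0#                       ∎)
      where
      b≉0 : b ≉ 0#
      b≉0 b≈0 = nonzero (a≈0 , b≈0)

  module PhiMap (_≟0 : ∀ x → Dec (x ≈ 0#)) (char₂ : HasCharacteristicTwo commutativeRing)
                {σ : Carrier → Carrier} (σ-hom : IsSemiringHomomorphism σ)
                (σ³-fixed : ∀ t → σ (σ (σ t)) ≈ t → t ≈ 0# ⊎ t ≈ 1#) where
    open FieldProperties F using (möbius-cycle)
    open CharacteristicTwo commutativeRing char₂
      using (x+x≈0; x+y≈0⇒x≈y; x≈y⇒x+y≈0; x+y≈z⇒x≈z+y)
    open CharacteristicTwoPlane _≟0 char₂
    open IsSemiringHomomorphism σ-hom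
      renaming (⟦⟧-cong to σ-cong; +-homo to σ-+; *-homo to σ-*; 0#-homo to σ-0; 1#-homo to σ-1)
    open Algebra.Properties.CommutativeSemigroup +-commutativeSemigroup
      using () renaming (interchange to +-interchange)
    open Algebra.Properties.Group +-group using () renaming (∙-cancelˡ to +-cancelˡ)

    σ-≉0 : ∀ {x} → x ≉ 0# → σ x ≉ 0#
    σ-≉0 {x} x≉0 σx≈0 = 0≉1 (begin
      0#           ≈⟨ zeroˡ _ ⟨
      0# * σ x⁻¹   ≈⟨ *-congʳ σx≈0 ⟨
      σ x * σ x⁻¹  ≈⟨ σ-* x x⁻¹ ⟨
      σ (x * x⁻¹)  ≈⟨ σ-cong (proj₂ (inverse x x≉0)) ⟩
      σ 1#         ≈⟨ σ-1 ⟩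
      1#           ∎)
      where x⁻¹ = proj₁ (inverse x x≉0)

    σ-fixed : ∀ t → σ t ≈ t → t ≈ 0# ⊎ t ≈ 1#
    σ-fixed t σt≈t = σ³-fixed t (trans (σ-cong (trans (σ-cong σt≈t) σt≈t)) σt≈t)

    σ-+₃ : ∀ a b c → σ ((a + b) + c) ≈ (σ a + σ b) + σ c
    σ-+₃ a b c = trans (σ-+ (a + b) c) (+-congʳ (σ-+ a b))

    φ : Point → Point
    φ (x , y) = (σ x + y) , ((σ y + x) + y)

    φ-cong : ∀ {P Q} → P ≈P Q → φ P ≈P φ Q
    φ-cong (x≈x′ , y≈y′) =
      +-cong (σ-cong x≈x′) y≈y′ , +-cong (+-cong (σ-cong y≈y′) x≈x′) y≈y′

    φ-+ : ∀ P Q → φ (P +P Q) ≈P (φ P +P φ Q)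
    φ-+ (x , y) (x′ , y′) =
      trans (+-congʳ (σ-+ x x′)) (+-interchange (σ x) (σ x′) y y′) ,
      trans (+-congʳ (trans (+-congʳ (σ-+ y y′)) (+-interchange (σ y) (σ y′) x x′)))
            (+-interchange (σ y + x) (σ y′ + x′) y y′)

    σ²x+x+σx≈0⇒σ³x≈x : ∀ {x} → (σ (σ x) + x) + σ x ≈ 0# → σ (σ (σ x)) ≈ x
    σ²x+x+σx≈0⇒σ³x≈x {x} E = x+y≈0⇒x≈y (begin
      σ (σ (σ x)) + x                                          ≈⟨ pairs-cancel _ _ _ _ ⟨
      ((σ (σ (σ x)) + σ x) + σ (σ x)) + ((σ (σ x) + x) + σ x)  ≈⟨ +-cong σE E ⟩
      0# + 0#                                                  ≈⟨ +-identityʳ 0# ⟩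
      0#                                                       ∎)
      where
      σE : (σ (σ (σ x)) + σ x) + σ (σ x) ≈ 0#
      σE = trans (sym (σ-+₃ _ _ _)) (trans (σ-cong E) σ-0)
      pairs-cancel : ∀ a b c d → ((a + b) + c) + ((c + d) + b) ≈ a + d
      pairs-cancel a b c d = begin
        ((a + b) + c) + ((c + d) + b)  ≈⟨ solve 4 (λ a b c d → ((a :+ b) :+ c) :+ ((c :+ d) :+ b) :=
                                            (a :+ d) :+ ((b :+ b) :+ (c :+ c))) refl a b c d ⟩
        (a + d) + ((b + b) + (c + c))  ≈⟨ +-congˡ (trans (+-cong (x+x≈0 b) (x+x≈0 c)) (+-identityʳ 0#)) ⟩
        (a + d) + 0#                   ≈⟨ +-identityʳ (a + d) ⟩
        a + d                          ∎

    φ-kernel : ∀ {x y} → φ (x , y) ≈P (0# , 0#) → (x , y) ≈P (0# , 0#)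
    φ-kernel {x} {y} (σx+y≈0 , σy+x+y≈0) = x≈0 , trans y≈σx (trans (σ-cong x≈0) σ-0)
      where
      y≈σx : y ≈ σ x
      y≈σx = sym (x+y≈0⇒x≈y σx+y≈0)
      E : (σ (σ x) + x) + σ x ≈ 0#
      E = trans (+-cong (+-congʳ (σ-cong (sym y≈σx))) (sym y≈σx)) σy+x+y≈0
      x≈0 : x ≈ 0#
      x≈0 with σ³-fixed x (σ²x+x+σx≈0⇒σ³x≈x E)
      ... | inj₁ x≈0 = x≈0
      ... | inj₂ x≈1 = ⊥-elim (0≉1 (begin
        0#                   ≈⟨ E ⟨
        (σ (σ x) + x) + σ x  ≈⟨ +-cong (+-cong σσx≈1 x≈1) σx≈1 ⟩
        (1# + 1#) + 1#       ≈⟨ +-congʳ char₂ ⟩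
        0# + 1#              ≈⟨ +-identityˡ 1# ⟩
        1#                   ∎))
        where
        σx≈1 = trans (σ-cong x≈1) σ-1
        σσx≈1 = trans (σ-cong σx≈1) σ-1

    φ-injective : ∀ P Q → φ P ≈P φ Q → P ≈P Q
    φ-injective P Q (e , e′) = x+y≈0⇒x≈y (proj₁ P+Q≈0) , x+y≈0⇒x≈y (proj₂ P+Q≈0)
      where
      P+Q≈0 = φ-kernel (trans (proj₁ (φ-+ P Q)) (x≈y⇒x+y≈0 e) ,
                        trans (proj₂ (φ-+ P Q)) (x≈y⇒x+y≈0 e′))

    σ-map-relation : ∀ {x y} → x * y + y ≈ 1# → σ x * σ y + σ y ≈ 1#
    σ-map-relation {x} {y} eq =
      trans (sym (trans (σ-+ (x * y) y) (+-congʳ (σ-* x y)))) (trans (σ-cong eq) σ-1)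

    tσt+σt≉1 : ∀ t → t * σ t + σ t ≉ 1#
    tσt+σt≉1 t eq with σ³-fixed t (möbius-cycle char₂ eq (σ-map-relation eq)
                                                  (σ-map-relation (σ-map-relation eq)))
    ... | inj₁ t≈0 = 0≉1 (begin
      0#             ≈⟨ +-identityʳ 0# ⟨
      0# + 0#        ≈⟨ +-cong (trans (*-congʳ t≈0) (zeroˡ _)) σt≈0 ⟨
      t * σ t + σ t  ≈⟨ eq ⟩
      1#             ∎)
      where σt≈0 = trans (σ-cong t≈0) σ-0
    ... | inj₂ t≈1 = 0≉1 (begin
      0#             ≈⟨ char₂ ⟨
      1# + 1#        ≈⟨ +-cong (trans (*-cong t≈1 σt≈1) (*-identityˡ 1#)) σt≈1 ⟨
      t * σ t + σ t  ≈⟨ eq ⟩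
      1#             ∎)
      where σt≈1 = trans (σ-cong t≈1) σ-1

    Q : Point → Carrier
    Q (x , y) = (x * σ x + y * σ x) + y * σ y

    Q≈yσy[tσt+σt]+yσy : ∀ {x y t} → x ≈ t * y → Q (x , y) ≈ (y * σ y) * (t * σ t + σ t) + y * σ y
    Q≈yσy[tσt+σt]+yσy {x} {y} {t} x≈ty = begin
      (x * σ x + y * σ x) + y * σ y                        ≈⟨ +-congʳ (+-cong (*-cong x≈ty σx≈)
                                                                              (*-congˡ σx≈)) ⟩
      ((t * y) * (σ t * σ y) + y * (σ t * σ y)) + y * σ y  ≈⟨ solve 4 (λ t y σt σy →
            ((t :* y) :* (σt :* σy) :+ y :* (σt :* σy)) :+ y :* σy :=
            (y :* σy) :* (t :* σt :+ σt) :+ y :* σy) refl t y (σ t) (σ y) ⟩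
      (y * σ y) * (t * σ t + σ t) + y * σ y                ∎
      where σx≈ = trans (σ-cong x≈ty) (σ-* t y)

    Q-≉0 : ∀ {u} → ¬ u ≈P (0# , 0#) → Q u ≉ 0#
    Q-≉0 {x , y} u≉0 Q≈0 with y ≟0
    ... | yes y≈0 = x≉0∧y≉0⇒x*y≉0 x≉0 (σ-≉0 x≉0) (begin
        x * σ x                        ≈⟨ +-identityʳ _ ⟨
        x * σ x + 0#                   ≈⟨ +-identityʳ _ ⟨
        (x * σ x + 0#) + 0#            ≈⟨ +-cong (+-congˡ (yσ≈0 x)) (yσ≈0 y) ⟨
        (x * σ x + y * σ x) + y * σ y  ≈⟨ Q≈0 ⟩
        0#                             ∎)
      where
      x≉0 : x ≉ 0#
      x≉0 x≈0 = u≉0 (x≈0 , y≈0)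
      yσ≈0 : ∀ z → y * σ z ≈ 0#
      yσ≈0 z = trans (*-congʳ y≈0) (zeroˡ (σ z))
    ... | no y≉0 = tσt+σt≉1 t (*-cancelˡ yσy≉0 (begin
        (y * σ y) * (t * σ t + σ t)  ≈⟨ x+y≈z⇒x≈z+y (trans (sym (Q≈yσy[tσt+σt]+yσy x≈ty)) Q≈0) ⟩
        0# + y * σ y                 ≈⟨ +-identityˡ _ ⟩
        y * σ y                      ≈⟨ *-identityʳ _ ⟨
        (y * σ y) * 1#               ∎))
      where
      t = proj₁ (≉0⇒quotient y≉0 x)
      x≈ty = proj₂ (≉0⇒quotient y≉0 x)
      yσy≉0 = x≉0∧y≉0⇒x*y≉0 y≉0 (σ-≉0 y≉0)

    det-φ-scaled : ∀ l u → det (φ u) (φ (l ·P u)) ≈ (l + σ l) * Q u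
    det-φ-scaled l (x , y) = begin
      det (φ (x , y)) (φ (l ·P (x , y)))
        ≈⟨ det-cong {φ (x , y)} (refl , refl) (+-congʳ (σ-* l x) , +-congʳ (+-congʳ (σ-* l y))) ⟩
      (σ x + y) * ((σ l * σ y + l * x) + l * y) + ((σ y + x) + y) * (σ l * σ x + l * y)
        ≈⟨ expand x y (σ x) (σ y) l (σ l) ⟩
      (l + σ l) * Q (x , y) + (Z + Z)
        ≈⟨ +-congˡ (x+x≈0 Z) ⟩
      (l + σ l) * Q (x , y) + 0#
        ≈⟨ +-identityʳ _ ⟩
      (l + σ l) * Q (x , y) ∎
      where
      Z = (σ l * σ x * σ y + l * x * y) + l * y * y
      -- a ring identity, whose excess term Z + Z vanishes in characteristic two
      expand : ∀ x y σx σy l σl →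
        (σx + y) * ((σl * σy + l * x) + l * y) + ((σy + x) + y) * (σl * σx + l * y) ≈
        (l + σl) * ((x * σx + y * σx) + y * σy) +
        (((σl * σx * σy + l * x * y) + l * y * y) + ((σl * σx * σy + l * x * y) + l * y * y))
      expand = solve 6 (λ x y σx σy l σl →
        (σx :+ y) :* ((σl :* σy :+ l :* x) :+ l :* y) :+ ((σy :+ x) :+ y) :* (σl :* σx :+ l :* y) :=
        (l :+ σl) :* ((x :* σx :+ y :* σx) :+ y :* σy) :+
        (((σl :* σx :* σy :+ l :* x :* y) :+ l :* y :* y) :+
         ((σl :* σx :* σy :+ l :* x :* y) :+ l :* y :* y))) refl

    φ-preserves-independence : ∀ {u w} → ¬ u ≈P (0# , 0#) → ¬ w ≈P (0# , 0#) → ¬ w ≈P u →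
                               det u w ≈ 0# → det (φ u) (φ w) ≉ 0#
    φ-preserves-independence {u@(x , y)} {w} u≉0 w≉0 w≉u det≈0 detφ≈0 =
      x≉0∧y≉0⇒x*y≉0 l+σl≉0 (Q-≉0 u≉0) (begin
        (l + σ l) * Q u         ≈⟨ det-φ-scaled l u ⟨
        det (φ u) (φ (l ·P u))  ≈⟨ det-cong {φ u} (refl , refl) (φ-cong w≈lu) ⟨
        det (φ u) (φ w)         ≈⟨ detφ≈0 ⟩
        0#                      ∎)
      where
      l = proj₁ (det≈0⇒proportional u≉0 det≈0)
      w≈lu = proj₂ (det≈0⇒proportional u≉0 det≈0)
      w≈ : ∀ {k x″ y″} → l ≈ k → k * x ≈ x″ → k * y ≈ y″ → w ≈P (x″ , y″)
      w≈ l≈k kx≈ ky≈ = trans (proj₁ w≈lu) (trans (*-congʳ l≈k) kx≈) ,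
                       trans (proj₂ w≈lu) (trans (*-congʳ l≈k) ky≈)
      l+σl≉0 : l + σ l ≉ 0#
      l+σl≉0 l+σl≈0 with σ-fixed l (sym (x+y≈0⇒x≈y l+σl≈0))
      ... | inj₁ l≈0 = w≉0 (w≈ l≈0 (zeroˡ x) (zeroˡ y))
      ... | inj₂ l≈1 = w≉u (w≈ l≈1 (*-identityˡ x) (*-identityˡ y))

    φ-oval : ∀ L P Q R → P ∈L L → Q ∈L L → R ∈L L →
             ¬ φ P ≈P φ Q → ¬ φ P ≈P φ R → ¬ φ Q ≈P φ R → ¬ Collinear (φ P) (φ Q) (φ R)
    φ-oval L P@(p , p′) Q@(q , q′) R@(r , r′) P∈L Q∈L R∈L φP≉φQ φP≉φR φQ≉φR
           (M , φP∈M , φQ∈M , φR∈M) =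
      φ-preserves-independence u≉0 w≉0 w≉u
        (∥L⇒det≈0 L (∈L⇒+P-∥L L P∈L Q∈L) (∈L⇒+P-∥L L P∈L R∈L))
        (trans (det-cong (φ-+ P Q) (φ-+ P R))
               (∥L⇒det≈0 M (∈L⇒+P-∥L M φP∈M φQ∈M) (∈L⇒+P-∥L M φP∈M φR∈M)))
      where
      u = P +P Q
      w = P +P R
      u≉0 : ¬ u ≈P (0# , 0#)
      u≉0 (e , e′) = φP≉φQ (φ-cong (x+y≈0⇒x≈y e , x+y≈0⇒x≈y e′))
      w≉0 : ¬ w ≈P (0# , 0#)
      w≉0 (e , e′) = φP≉φR (φ-cong (x+y≈0⇒x≈y e , x+y≈0⇒x≈y e′))
      w≉u : ¬ w ≈P u
      w≉u (e , e′) = φQ≉φR (φ-cong (sym (+-cancelˡ p r q e) , sym (+-cancelˡ p′ r′ q′ e′)))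

open import Data.Nat using (_*_; NonZero)

lemma3p14 : ∀ {c ℓ : Level} (n k : ℕ) → NonZero n → NonZero k →
            gcd (3 * k) n ≡ 1 →
            (F : FieldOfOrder2^ n c ℓ) →
            AffinePlane.AffineOvalinear (FieldOfOrder2^.fld F)
              (AffinePlane.phi (FieldOfOrder2^.fld F) k)
lemma3p14 n k _ _ coprime F = record
  { additive   = φ-+
  ; injective  = φ-injective
  ; surjective = point-injective⇒surjective φ φ-injective
  ; oval       = φ-oval
  }
  where
  open FieldOfOrder2^ F using (fld; _≈_; 0#; 1#; trans; sym)
  open FiniteField F using (_≟0; char₂; ^2^-fixed⇒0∨1; point-injective⇒surjective)
  open FieldProperties fld using (frobenius; frobenius³; frobenius-isSemiringHomomorphism)
  σ³-fixed : ∀ t → frobenius k (frobenius k (frobenius k t)) ≈ t → t ≈ 0# ⊎ t ≈ 1#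
  σ³-fixed t fixed = ^2^-fixed⇒0∨1 {3 * k} coprime (trans (sym (frobenius³ k t)) fixed)
  open PhiMap fld _≟0 char₂ (frobenius-isSemiringHomomorphism char₂ k) σ³-fixed
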